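{- Let $\vdash$ be a logic and let $X=\langle \langle I,\vee\rangle,\{\langle \mathbf{A}_i,F_i\rangle\}_{i\in I},\{f_{ij}: i\le j\}\rangle$ be a directed system of matrices such that every $\langle \mathbf{A}_i,F_i\rangle$ is a model of $\vdash$. Then the Płonka sum $\mathrm{PL}(X)$ is a model of the left variable inclusion companion $\vdash^{l}$ of $\vdash$.
   Context: Fix an algebraic language without constant symbols; $\mathbf{Fm}$ is the algebra of formulas over a countably infinite set $\mathrm{Var}$ of variables, $\mathrm{Var}(\varphi)$ is the set of variables occurring in $\varphi$ and $\mathrm{Var}(\Gamma)=\bigcup_{\gamma\in\Gamma}\mathrm{Var}(\gamma)$. A logic is a substitution-invariant consequence relation $\vdash\subseteq\mathcal{P}(Fm)\times Fm$. A matrix is a pair $\langle\mathbf{A},F\rangle$ with $F\subseteq A$; it is a model of $\vdash$ if whenever $\Gamma\vdash\varphi$ and $h\colon\mathbf{Fm}\to\mathbf{A}$ is a homomorphism with $h[\Gamma]\subseteq F$, then $h(\varphi)\in F$. The left variable inclusion companion $\vdash^{l}$ is defined by: $\Gamma\vdash^{l}\varphi$ iff there is $\Gamma'\subseteq\Gamma$ with $\mathrm{Var}(\Gamma')\subseteq\mathrm{Var}(\varphi)$ and $\Gamma'\vdash\varphi$. A directed system of matrices consists of a semilattice $\langle I,\vee\rangle$ (ordered by $i\le j$ iff $i\vee j=j$), matrices $\langle\mathbf{A}_i,F_i\rangle$, $i\in I$, with pairwise disjoint universes, and homomorphisms $f_{ij}\colon\mathbf{A}_i\to\mathbf{A}_j$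 for $i\le j$ with $f_{ij}[F_i]\subseteq F_j$, $f_{ii}$ the identity, and $f_{ik}=f_{jk}\circ f_{ij}$ for $i\le j\le k$. Its Płonka sum is the matrix $\mathrm{PL}(X)=\langle \mathbf{A},\bigcup_{i\in I}F_i\rangle$, where $\mathbf{A}$ has universe $\bigcup_{i\in I}A_i$ and, for each $n$-ary basic operation $f$ and $a_1\in A_{i_1},\dots,a_n\in A_{i_n}$, $f^{\mathbf{A}}(a_1,\dots,a_n)=f^{\mathbf{A}_j}(f_{i_1j}(a_1),\dots,f_{i_nj}(a_n))$ with $j=i_1\vee\dots\vee i_n$. -}

module Defs where

open import Data.Nat using (ℕ; suc)
open import Data.Vec using (Vec; []; _∷_; map)
open import Data.Vec.Relation.Unary.Any using (Any)
open import Data.Vec.Relation.Unary.All using (All; []; _∷_)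
open import Data.Product using (Σ; _×_; _,_; proj₁; proj₂; ∃)
import Level
open import Level using (Level) renaming (zero to lzero)
open import Relation.Binary.PropositionalEquality
  using (_≡_; refl; sym; trans; cong; cong₂)

-- An algebraic language WITHOUT constant symbols: every operation symbol o
-- has arity  suc (ar o) ≥ 1.
record Signature : Set₁ where
  field
    Op : Set
    ar : Op → ℕ

module _ (Σs : Signature) where
  open Signature Σs

  data Fm : Set where
    var : ℕ → Fm
    op  : (o : Op) → Vec Fm (suc (ar o)) → Fm

  data _occursIn_ (x : ℕ) : Fm → Set where
    here : x occursIn var x
    there : ∀ {o} {ts : Vec Fm (suc (ar o))} →
            Any (λ t → x occursIn t) ts → x occursIn op o ts

  FmSet : Set₁
  FmSet = Fm → Set

  _⊆_ : FmSet → FmSet → Set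
  Γ ⊆ Δ = ∀ φ → Γ φ → Δ φ

  VarsIncluded : FmSet → Fm → Set
  VarsIncluded Γ φ = ∀ γ x → Γ γ → x occursIn γ → x occursIn φ

  subst : (ℕ → Fm) → Fm → Fm
  substs : ∀ {n} → (ℕ → Fm) → Vec Fm n → Vec Fm n
  subst σ (var x) = σ x
  subst σ (op o ts) = op o (substs σ ts)
  substs σ [] = []
  substs σ (t ∷ ts) = subst σ t ∷ substs σ ts

  image : (ℕ → Fm) → FmSet → FmSet
  image σ Γ ψ = Σ Fm λ γ → Γ γ × (ψ ≡ subst σ γ)

  record Logic : Set₁ where
    field
      _⊢_ : FmSet → Fm → Set
      reflexive    : ∀ {Γ φ} → Γ φ → Γ ⊢ φ
      monotone     : ∀ {Γ Δ φ} → Γ ⊆ Δ → Γ ⊢ φ → Δ ⊢ φ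
      cut          : ∀ {Γ Δ φ} → (∀ ψ → Δ ψ → Γ ⊢ ψ) → Δ ⊢ φ → Γ ⊢ φ
      structural   : ∀ {Γ φ} (σ : ℕ → Fm) → Γ ⊢ φ → image σ Γ ⊢ subst σ φ

  _⊢ˡ_ : Logic → FmSet → Fm → Set₁
  _⊢ˡ_ L Γ φ = Σ FmSet λ Γ' → (Γ' ⊆ Γ) × VarsIncluded Γ' φ × (Logic._⊢_ L Γ' φ)

  record Matrix : Set₁ where
    field
      Carrier : Set
      ops     : (o : Op) → Vec Carrier (suc (ar o)) → Carrier
      F       : Carrier → Set

  module _ (M : Matrix) where
    open Matrix M
    IsHom : (Fm → Carrier) → Set
    IsHom h = ∀ o ts → h (op o ts) ≡ ops o (map h ts)

    IsModel : ∀ {ℓ} → (FmSet → Fm → Set ℓ) → Set (Level.suc lzero Level.⊔ ℓ)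
    IsModel R = ∀ Γ φ → R Γ φ → (h : Fm → Carrier) → IsHom h →
                (∀ γ → Γ γ → F (h γ)) → F (h φ)

  -- directed systems of matrices; the universes of the Płonka sum are
  -- taken as the disjoint union Σ I (Carrier ∘ A), so disjointness is built in
  record DirectedSystem : Set₁ where
    field
      I   : Set
      _∨_ : I → I → I
      ∨-assoc : ∀ i j k → (i ∨ j) ∨ k ≡ i ∨ (j ∨ k)
      ∨-comm  : ∀ i j → i ∨ j ≡ j ∨ i
      ∨-idem  : ∀ i → i ∨ i ≡ i
      A   : I → Matrix
    _≤_ : I → I → Set
    i ≤ j = i ∨ j ≡ j
    field
      f   : ∀ {i j} → i ≤ j → Matrix.Carrier (A i) → Matrix.Carrier (A j)
      f-hom  : ∀ {i j} (p : i ≤ j) → ∀ o (as : Vec (Matrix.Carrier (A i)) (suc (ar o))) →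
               f p (Matrix.ops (A i) o as) ≡ Matrix.ops (A j) o (map (f p) as)
      f-filter : ∀ {i j} (p : i ≤ j) a → Matrix.F (A i) a → Matrix.F (A j) (f p a)
      f-id   : ∀ {i} (p : i ≤ i) a → f p a ≡ a
      f-comp : ∀ {i j k} (p : i ≤ j) (q : j ≤ k) (r : i ≤ k) a →
               f r a ≡ f q (f p a)

    join : ∀ {n} → Vec I (suc n) → I
    join (i ∷ []) = i
    join (i ∷ k ∷ ks) = i ∨ join (k ∷ ks)

    Elem : Set
    Elem = Σ I (λ i → Matrix.Carrier (A i))

    private
      open import Relation.Binary.PropositionalEquality using (module ≡-Reasoning)
      upper-step : ∀ x z J → z ∨ J ≡ J → z ∨ (x ∨ J) ≡ x ∨ J
      upper-step x z J e =
        trans (sym (∨-assoc z x J))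
          (trans (cong (_∨ J) (∨-comm z x))
            (trans (∨-assoc x z J) (cong (x ∨_) e)))
      upper-self : ∀ x J → x ∨ (x ∨ J) ≡ x ∨ J
      upper-self x J = trans (sym (∨-assoc x x J)) (cong (_∨ J) (∨-idem x))

      mapAll : ∀ {n} {P Q : Elem → Set} → (∀ {a} → P a → Q a) →
               {as : Vec Elem n} → All P as → All Q as
      mapAll g [] = []
      mapAll g (p ∷ ps) = g p ∷ mapAll g ps

    joinUpper : ∀ {n} (as : Vec Elem (suc n)) →
                All (λ a → proj₁ a ≤ join (map proj₁ as)) as
    joinUpper (a ∷ []) = ∨-idem (proj₁ a) ∷ []
    joinUpper (a ∷ b ∷ bs) =
      upper-self (proj₁ a) (join (map proj₁ (b ∷ bs))) ∷
      mapAll (λ {c} e → upper-step (proj₁ a) (proj₁ c) _ e) (joinUpper (b ∷ bs))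

    pushAll : ∀ {n} (j : I) (as : Vec Elem n) → All (λ a → proj₁ a ≤ j) as →
              Vec (Matrix.Carrier (A j)) n
    pushAll j [] [] = []
    pushAll j (a ∷ as) (p ∷ ps) = f p (proj₂ a) ∷ pushAll j as ps

    PL : Matrix
    PL = record
      { Carrier = Elem
      ; ops = λ o as →
          let j = join (map proj₁ as) in
          j , Matrix.ops (A j) o (pushAll j as (joinUpper as))
      ; F = λ a → Matrix.F (A (proj₁ a)) (proj₂ a)
      }

-- For a homomorphism h into PL(X) let idx t be the component containing h t;
-- it is the join of idx x over the variables x of t.  Hence if Var(Γ') ⊆ Var(φ),
-- every h γ (γ ∈ Γ') can be pushed into A_j, j = idx φ, along f.  The valuation
-- x ↦ f(h x) into A_j evaluates every formula with variables in Var(φ) to the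
-- push of its h-value, so Γ' ⊢ φ and the model property of A_j give
-- f(h φ) = h φ ∈ F_j.
module Submission where

open import Defs
open import Data.Nat using (ℕ; suc; _≟_)
open import Data.Vec using (Vec; []; _∷_; map)
open import Data.Vec.Relation.Unary.Any using (Any; here; there)
open import Data.Vec.Relation.Unary.All as All using (All; []; _∷_)
open import Data.Product using (_,_; proj₁; proj₂)
open import Relation.Nullary using (Dec; yes; no)
open import Relation.Nullary.Negation using (contradiction)
open import Relation.Binary.PropositionalEquality as ≡
  using (_≡_; refl; sym; trans; cong; cong₂)

module _ (S : Signature) where
  private
    _∈Var_ : ℕ → Fm S → Set
    x ∈Var t = _occursIn_ S x t

    _∈Vars_ : ∀ {n} → ℕ → Vec (Fm S) n → Set
    x ∈Vars ts = Any (x ∈Var_) ts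

  _∈Var?_ : ∀ x t → Dec (x ∈Var t)
  _∈Vars?_ : ∀ {n} x (ts : Vec (Fm S) n) → Dec (x ∈Vars ts)
  x ∈Var? var y with x ≟ y
  ... | yes refl = yes here
  ... | no x≢y = no λ { here → x≢y refl }
  x ∈Var? op o ts with x ∈Vars? ts
  ... | yes x∈ts = yes (there x∈ts)
  ... | no x∉ts = no λ { (there x∈ts) → x∉ts x∈ts }
  x ∈Vars? [] = no λ ()
  x ∈Vars? (t ∷ ts) with x ∈Var? t | x ∈Vars? ts
  ... | yes x∈t | _ = yes (here x∈t)
  ... | no _ | yes x∈ts = yes (there x∈ts)
  ... | no x∉t | no x∉ts = no λ { (here x∈t) → x∉t x∈t ; (there x∈ts) → x∉ts x∈ts }

  module Evaluation (M : Matrix S) where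
    open Matrix M

    eval : (ℕ → Carrier) → Fm S → Carrier
    evals : ∀ {n} → (ℕ → Carrier) → Vec (Fm S) n → Vec Carrier n
    eval v (var x) = v x
    eval v (op o ts) = ops o (evals v ts)
    evals v [] = []
    evals v (t ∷ ts) = eval v t ∷ evals v ts

    evals≡map-eval : ∀ {n} v (ts : Vec (Fm S) n) → evals v ts ≡ map (eval v) ts
    evals≡map-eval v [] = refl
    evals≡map-eval v (t ∷ ts) = cong (eval v t ∷_) (evals≡map-eval v ts)

    eval-isHom : ∀ v → IsHom S M (eval v)
    eval-isHom v o ts = cong (ops o) (evals≡map-eval v ts)

  module PlonkaSum (X : DirectedSystem S) where
    open DirectedSystem X

    ≤-trans : ∀ {i j k} → i ≤ j → j ≤ k → i ≤ k
    ≤-trans {i} {j} {k} i≤j j≤k = begin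
      i ∨ k        ≡⟨ cong (i ∨_) (sym j≤k) ⟩
      i ∨ (j ∨ k)  ≡⟨ sym (∨-assoc i j k) ⟩
      (i ∨ j) ∨ k  ≡⟨ cong (_∨ k) i≤j ⟩
      j ∨ k        ≡⟨ j≤k ⟩
      k            ∎
      where open ≡.≡-Reasoning

    join-least : ∀ {n} (is : Vec I (suc n)) {k} → All (_≤ k) is → join is ≤ k
    join-least (i ∷ []) (i≤k ∷ []) = i≤k
    join-least (i ∷ i′ ∷ is) {k} (i≤k ∷ is≤k) =
      trans (∨-assoc i _ k) (trans (cong (i ∨_) (join-least (i′ ∷ is) is≤k)) i≤k)

    -- _≤_ is an equation in I, which need not be a set, so this is not automatic.
    f-irrelevant : ∀ {i j} (p q : i ≤ j) a → f p a ≡ f q a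
    f-irrelevant p q a = trans (f-comp (∨-idem _) q p a) (cong (f q) (f-id _ a))

    f-cong : ∀ {a b : Elem} {j} → a ≡ b → (p : proj₁ a ≤ j) (q : proj₁ b ≤ j) →
             f p (proj₂ a) ≡ f q (proj₂ b)
    f-cong refl p q = f-irrelevant p q _

    map-f-pushAll : ∀ {n j k} (as : Vec Elem n) (as≤j : All (λ a → proj₁ a ≤ j) as)
                    (j≤k : j ≤ k) →
                    map (f j≤k) (pushAll j as as≤j) ≡
                    pushAll k as (All.map (λ p → ≤-trans p j≤k) as≤j)
    map-f-pushAll [] [] j≤k = refl
    map-f-pushAll (a ∷ as) (p ∷ ps) j≤k =
      cong₂ _∷_ (sym (f-comp p j≤k _ _)) (map-f-pushAll as ps j≤k)

    module IntoPL (h : Fm S → Elem) (h-hom : IsHom S PL h) where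
      idx : Fm S → I
      idx t = proj₁ (h t)

      idx-var≤idx : ∀ {x} t → x ∈Var t → idx (var x) ≤ idx t
      idx-var≤bound : ∀ {n x} (ts : Vec (Fm S) n) {k} → x ∈Vars ts →
                      All (λ a → proj₁ a ≤ k) (map h ts) → idx (var x) ≤ k
      idx-var≤idx (var x) here = ∨-idem _
      idx-var≤idx (op o ts) (there x∈ts) =
        ≡.subst (λ a → _ ≤ proj₁ a) (sym (h-hom o ts))
          (idx-var≤bound ts x∈ts (joinUpper (map h ts)))
      idx-var≤bound (t ∷ ts) (here x∈t) (t≤k ∷ _) = ≤-trans (idx-var≤idx t x∈t) t≤k
      idx-var≤bound (t ∷ ts) (there x∈ts) (_ ∷ ts≤k) = idx-var≤bound ts x∈ts ts≤k

      idx-least : ∀ t {k} → (∀ x → x ∈Var t → idx (var x) ≤ k) → idx t ≤ k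
      idxs-least : ∀ {n} (ts : Vec (Fm S) n) {k} → (∀ x → x ∈Vars ts → idx (var x) ≤ k) →
                   All (_≤ k) (map proj₁ (map h ts))
      idx-least (var x) vars≤k = vars≤k x here
      idx-least (op o ts) vars≤k =
        ≡.subst (λ a → proj₁ a ≤ _) (sym (h-hom o ts))
          (join-least (map proj₁ (map h ts)) (idxs-least ts λ x x∈ts → vars≤k x (there x∈ts)))
      idxs-least [] vars≤k = []
      idxs-least (t ∷ ts) vars≤k =
        idx-least t (λ x x∈t → vars≤k x (here x∈t)) ∷ idxs-least ts (λ x x∈ts → vars≤k x (there x∈ts))

      module _ {j} (v : ℕ → Matrix.Carrier (A j)) where
        open Matrix (A j) using () renaming (ops to opsⱼ)
        open Evaluation (A j)

        AgreesAt : ℕ → Set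
        AgreesAt x = (p : idx (var x) ≤ j) → v x ≡ f p (proj₂ (h (var x)))

        eval≡f : ∀ t (t≤j : idx t ≤ j) → (∀ x → x ∈Var t → AgreesAt x) →
                 eval v t ≡ f t≤j (proj₂ (h t))
        evals≡pushAll : ∀ {n} (ts : Vec (Fm S) n) (ts≤j : All (λ a → proj₁ a ≤ j) (map h ts)) →
                        (∀ x → x ∈Vars ts → AgreesAt x) → evals v ts ≡ pushAll j (map h ts) ts≤j
        eval≡f (var x) x≤j agrees = agrees x here x≤j
        eval≡f (op o ts) t≤j agrees = begin
          opsⱼ o (evals v ts)                                ≡⟨ cong (opsⱼ o) (evals≡pushAll ts _ agrees-ts) ⟩
          opsⱼ o (pushAll j as _)                            ≡⟨ cong (opsⱼ o) (sym (map-f-pushAll as (joinUpper as) J≤j)) ⟩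
          opsⱼ o (map (f J≤j) (pushAll J as (joinUpper as))) ≡⟨ sym (f-hom J≤j o _) ⟩
          f J≤j (proj₂ (Matrix.ops PL o as))                 ≡⟨ f-cong (sym (h-hom o ts)) J≤j t≤j ⟩
          f t≤j (proj₂ (h (op o ts)))                        ∎
          where
          open ≡.≡-Reasoning
          as = map h ts
          J = join (map proj₁ as)
          J≤j : J ≤ j
          J≤j = ≡.subst (λ a → proj₁ a ≤ j) (h-hom o ts) t≤j
          agrees-ts : ∀ x → x ∈Vars ts → AgreesAt x
          agrees-ts x x∈ts = agrees x (there x∈ts)
        evals≡pushAll [] [] agrees = refl
        evals≡pushAll (t ∷ ts) (t≤j ∷ ts≤j) agrees =
          cong₂ _∷_ (eval≡f t t≤j λ x x∈t → agrees x (here x∈t))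
                    (evals≡pushAll ts ts≤j λ x x∈ts → agrees x (there x∈ts))

      -- Variables outside Var(φ) are sent to the arbitrary element h φ of A_{idx φ}.
      pushVars : (φ : Fm S) → ℕ → Matrix.Carrier (A (idx φ))
      pushVars φ x with x ∈Var? φ
      ... | yes x∈φ = f (idx-var≤idx φ x∈φ) (proj₂ (h (var x)))
      ... | no _ = proj₂ (h φ)

      pushVars-agrees : ∀ φ {x} → x ∈Var φ → AgreesAt (pushVars φ) x
      pushVars-agrees φ {x} x∈φ p with x ∈Var? φ
      ... | yes _ = f-irrelevant _ p _
      ... | no x∉φ = contradiction x∈φ x∉φ

lemma3p6 : (S : Signature) (L : Logic S) (X : DirectedSystem S) →
    (∀ i → IsModel S (DirectedSystem.A X i) (Logic._⊢_ L)) →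
    IsModel S (DirectedSystem.PL X) (_⊢ˡ_ S L)
lemma3p6 S L X models Γ φ (Γ′ , Γ′⊆Γ , vars⊆ , Γ′⊢φ) h h-hom hΓ =
  ≡.subst Fⱼ (trans (eval≡f v φ (∨-idem j) agrees) (f-id _ _))
    (models j Γ′ φ Γ′⊢φ (eval v) (eval-isHom v) premises)
  where
  open DirectedSystem X
  open PlonkaSum S X
  open IntoPL h h-hom
  j : I
  j = idx φ
  open Evaluation S (A j)
  Fⱼ : Matrix.Carrier (A j) → Set
  Fⱼ = Matrix.F (A j)
  v : ℕ → Matrix.Carrier (A j)
  v = pushVars φ
  agrees : ∀ x → _occursIn_ S x φ → AgreesAt v x
  agrees x = pushVars-agrees φ
  premises : ∀ γ → Γ′ γ → Fⱼ (eval v γ)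
  premises γ γ∈Γ′ =
    ≡.subst Fⱼ (sym (eval≡f v γ γ≤j λ x x∈γ → agrees x (vars⊆ γ x γ∈Γ′ x∈γ)))
      (f-filter γ≤j _ (hΓ γ (Γ′⊆Γ γ γ∈Γ′)))
    where
    γ≤j : idx γ ≤ j
    γ≤j = idx-least γ λ x x∈γ → idx-var≤idx φ (vars⊆ γ x γ∈Γ′ x∈γ)
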